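{- Let $x\geq 3$ be an odd integer and let $1\leq s\leq x-1$. Then there exists a standard linear realization of every list $$\{1^{x-1},2^{b_2},4^{b_4},6^{b_6},\ldots,(x-1)^{b_{x-1}},x^s\}$$ in which the exponents $b_2,b_4,\ldots,b_{x-1}$ are all even and nonnegative.
   Context: The notation $\{1^{a_1},\ldots,t^{a_t}\}$ denotes the multiset with $a_i$ copies of $i$. For a list (multiset) $L$ of positive integers with $|L|$ elements, a linear realization of $L$ is an ordering $[x_0,\ldots,x_{|L|}]$ of $\{0,1,\ldots,|L|\}$ such that the multiset $\{|x_i-x_{i+1}|:0\le i\le |L|-1\}$ equals $L$; it is standard if $x_0=0$. -}

module Defs where

open import Data.Nat using (ℕ; zero; suc; _*_; _∸_; ∣_-_∣)
open import Data.Fin using (Fin; toℕ)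
open import Data.List using (List; []; _∷_; _++_; length; replicate; concatMap; upTo; allFin)
open import Data.List.Relation.Binary.Permutation.Propositional using (_↭_)
open import Data.Product using (_×_; ∃)
open import Relation.Binary.PropositionalEquality using (_≡_)

diffs : List ℕ → List ℕ
diffs (a ∷ b ∷ r) = ∣ a - b ∣ ∷ diffs (b ∷ r)
diffs _ = []

-- Multisets are lists up to permutation (_↭_).
-- A linear realization of L: an ordering of {0,…,|L|} whose multiset of
-- consecutive absolute differences equals L.
LinearRealization : List ℕ → List ℕ → Set
LinearRealization L xs = (xs ↭ upTo (suc (length L))) × (diffs xs ↭ L)

StandardLinearRealization : List ℕ → List ℕ → Set
StandardLinearRealization L xs = LinearRealization L xs × ∃ λ ys → xs ≡ 0 ∷ ys

-- The list {1^(x-1), 2^b_2, 4^b_4, …, (x-1)^b_(x-1), x^s} for odd x,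
-- where b i (i : Fin (x/2)) is the multiplicity of the even value 2(i+1).
theList : (x : ℕ) → (Fin (Data.Nat._/_ x 2) → ℕ) → ℕ → List ℕ
theList x b s =
  replicate (x ∸ 1) 1
  ++ concatMap (λ i → replicate (b i) (2 * suc (toℕ i))) (allFin _)
  ++ replicate s x

-- The proof is a growth argument driven by one local operation, *surgery*: if
-- the values p and p+1 are consecutive in a realization of L on {0,…,N} and
-- p + v = N + 1, then replacing the segment  a, c  ({a,c} = {p,p+1}) by
-- a, a+v, c+v, c  gives a realization of v ∷ v ∷ L on {0,…,N+2}.  We call such
-- a p a *pivot* for v.  After the surgery N+1 is a pivot for 2, and every old
-- pivot for w ≠ v survives as a pivot for w + 2 (lemma `extend`).
--
-- So pivot sets shift upwards by 2 and regain 2.  This yields two phases: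
--  * odd phase (`odd-phase`): from an explicit base realization of 1^(2K) x
--    (s = 1) or 1^(2K) x² (s = 2) with pivots for 2,4,…,2K and for the odd
--    values 2f+1, f ≥ lo, repeatedly insert the pair x, x; each step keeps the
--    even pivots and loses only the smallest odd one, which suffices up to s = 2K.
--  * even phase (`even-phase`): with pivots for 2,4,…,2d, inserting the pair
--    2d, 2d keeps exactly these pivots; so the even values are inserted from
--    the largest down, b_(2d)/2 pairs at a time.
module Submission where

open import Defs
open import Data.Nat
  using (ℕ; zero; suc; _+_; _*_; _∸_; _≤_; _<_; _/_; _%_; z≤n; s≤s; ∣_-_∣; ⌊_/2⌋)
open import Data.Nat.Properties
open import Data.Nat.DivMod using (m≡m%n+[m/n]*n; m%n<n)
open import Data.Nat.Divisibility using (_∣_; divides)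
open import Data.Fin using (Fin; toℕ) renaming (zero to fzero; suc to fsuc)
open import Data.List
  using (List; []; _∷_; _++_; length; replicate; concatMap; concat; map; tabulate;
         allFin; upTo; applyUpTo; applyDownFrom)
open import Data.List.Properties
  using (length-replicate; length-upTo; upTo-∷ʳ; map-tabulate; tabulate-cong; ++-assoc)
open import Data.List.Relation.Binary.Permutation.Propositional
  using (_↭_; prep; swap; ↭-refl; ↭-sym; ↭-trans; ↭-reflexive)
open import Data.List.Relation.Binary.Permutation.Propositional.Properties
  using (↭-length; shifts; ∷↭∷ʳ; ++-comm)
open import Data.Product using (∃; _×_; _,_; proj₁; proj₂)
open import Data.Sum using (inj₁; inj₂)
open import Data.Empty using (⊥-elim)
open import Relation.Nullary using (¬_)
open import Relation.Binary.PropositionalEquality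
open import Function using (_∘_)

pull₂ : ∀ (u : ℕ) {v w : ℕ} {ys zs : List ℕ} → ys ↭ v ∷ w ∷ zs → u ∷ ys ↭ v ∷ w ∷ u ∷ zs
pull₂ u {v} {w} ys↭ = ↭-trans (prep u ys↭) (shifts (u ∷ []) (v ∷ w ∷ []))

upTo-suc : ∀ n → upTo (suc n) ↭ n ∷ upTo n
upTo-suc n = ↭-trans (↭-reflexive (sym (upTo-∷ʳ n))) (↭-sym (∷↭∷ʳ n (upTo n)))

grow-range : ∀ {N xs} → xs ↭ upTo (suc N) →
             suc N ∷ suc (suc N) ∷ xs ↭ upTo (suc (suc (suc N)))
grow-range {N} xs↭ =
  ↭-trans (swap (suc N) (suc (suc N)) xs↭)
    (↭-sym (↭-trans (upTo-suc (suc (suc N))) (prep (suc (suc N)) (upTo-suc (suc N)))))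

length-diffs : ∀ a ys → length (diffs (a ∷ ys)) ≡ length ys
length-diffs a [] = refl
length-diffs a (b ∷ ys) = cong suc (length-diffs b ys)

standard : ∀ {n L xs} → xs ↭ upTo (suc n) → diffs xs ↭ L → ∃ (λ ys → xs ≡ 0 ∷ ys) →
           StandardLinearRealization L xs
standard {n} {L} perm ds (ys , refl) =
  (subst (λ m → 0 ∷ ys ↭ upTo (suc m)) n≡|L| perm , ds) , ys , refl
  where
  n≡|L| : n ≡ length L
  n≡|L| = trans (suc-injective (trans (sym (length-upTo (suc n))) (sym (↭-length perm))))
                (trans (sym (length-diffs 0 ys)) (↭-length ds))

realization-↭ : ∀ {L T xs} → L ↭ T → StandardLinearRealization L xs →
                StandardLinearRealization T xs
realization-↭ L↭T ((perm , ds) , head) = standard perm (↭-trans ds L↭T) head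

data Adjacent (p : ℕ) : List ℕ → Set where
  rising  : ∀ {r} → Adjacent p (p ∷ suc p ∷ r)
  falling : ∀ {r} → Adjacent p (suc p ∷ p ∷ r)
  later   : ∀ {a r} → Adjacent p r → Adjacent p (a ∷ r)

spread : ℕ → ℕ → ℕ → List ℕ → List ℕ
spread v a c r = a ∷ a + v ∷ c + v ∷ c ∷ r

surgery : ∀ {p xs} → ℕ → Adjacent p xs → List ℕ
surgery {p} v (rising {r}) = spread v p (suc p) r
surgery {p} v (falling {r}) = spread v (suc p) p r
surgery v (later {a} h) = a ∷ surgery v h

∣-∣-translate : ∀ a c v → ∣ a + v - c + v ∣ ≡ ∣ a - c ∣
∣-∣-translate a c v = trans (cong₂ ∣_-_∣ (+-comm a v) (+-comm c v)) (∣m+n-m+o∣≡∣n-o∣ v a c)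

diffs-spread : ∀ v a c r → diffs (spread v a c r) ↭ v ∷ v ∷ diffs (a ∷ c ∷ r)
diffs-spread v a c r
  rewrite ∣m-m+n∣≡n a v | ∣-∣-translate a c v | ∣-∣-comm (c + v) c | ∣m-m+n∣≡n c v =
  prep v (swap ∣ a - c ∣ v ↭-refl)

surgery-diffs-after : ∀ {p xs} v b (h : Adjacent p xs) →
                      diffs (b ∷ surgery v h) ↭ v ∷ v ∷ diffs (b ∷ xs)
surgery-diffs-after {p} v b rising = pull₂ _ (diffs-spread v p (suc p) _)
surgery-diffs-after {p} v b falling = pull₂ _ (diffs-spread v (suc p) p _)
surgery-diffs-after v b (later {a} h) = pull₂ _ (surgery-diffs-after v a h)

surgery-diffs : ∀ {p xs} v (h : Adjacent p xs) → diffs (surgery v h) ↭ v ∷ v ∷ diffs xs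
surgery-diffs {p} v rising = diffs-spread v p (suc p) _
surgery-diffs {p} v falling = diffs-spread v (suc p) p _
surgery-diffs v (later {a} h) = surgery-diffs-after v a h

surgery-↭ : ∀ {p xs} v (h : Adjacent p xs) → surgery v h ↭ p + v ∷ suc p + v ∷ xs
surgery-↭ {p} v rising = pull₂ p ↭-refl
surgery-↭ {p} v falling = pull₂ (suc p) (swap _ _ ↭-refl)
surgery-↭ v (later {a} h) = pull₂ a (surgery-↭ v h)

surgery-head : ∀ {p b r} v (h : Adjacent p (b ∷ r)) → ∃ λ zs → surgery v h ≡ b ∷ zs
surgery-head v rising = _ , refl
surgery-head v falling = _ , refl
surgery-head v (later h) = _ , refl

surgery-new : ∀ {p xs} v (h : Adjacent p xs) → Adjacent (p + v) (surgery v h)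
surgery-new v rising = later rising
surgery-new v falling = later falling
surgery-new v (later h) = later (surgery-new v h)

surgery-keeps : ∀ {p q xs} v → Adjacent q xs → q ≢ p → (h : Adjacent p xs) →
                Adjacent q (surgery v h)
surgery-keeps v rising q≢p rising = ⊥-elim (q≢p refl)
surgery-keeps v falling q≢p falling = ⊥-elim (q≢p refl)
surgery-keeps v rising _ (later rising) = rising
surgery-keeps v rising _ (later falling) = rising
surgery-keeps v rising _ (later (later _)) = rising
surgery-keeps v falling _ (later rising) = falling
surgery-keeps v falling _ (later falling) = falling
surgery-keeps v falling _ (later (later _)) = falling
surgery-keeps v (later hq) _ rising = later (later (later hq))
surgery-keeps v (later hq) _ falling = later (later (later hq))
surgery-keeps v (later hq) q≢p (later h) = later (surgery-keeps v hq q≢p h)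

-- Pivot n xs v: an adjacent pair {p, p+1} of xs with p + v = n + 1; at it,
-- surgery inserts v into a realization on {0, …, n}.
Pivot : ℕ → List ℕ → ℕ → Set
Pivot n xs v = ∃ λ p → p + v ≡ suc n × Adjacent p xs

record Extension (v : ℕ) (L xs : List ℕ) : Set where
  field
    list     : List ℕ
    realizes : StandardLinearRealization (v ∷ v ∷ L) list
    pivot₂   : Pivot (length (v ∷ v ∷ L)) list 2
    shifted  : ∀ w → w ≢ v → Pivot (length L) xs w → Pivot (length (v ∷ v ∷ L)) list (2 + w)

extend : ∀ {v L xs} → StandardLinearRealization L xs → Pivot (length L) xs v →
         Extension v L xs
extend {v} {L} ((xs↭ , ds) , ys , refl) (p , p+v≡ , adj) = record
  { list     = surgery v adj
  ; realizes = standard perm (↭-trans (surgery-diffs v adj) (prep v (prep v ds)))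
                        (surgery-head v adj)
  ; pivot₂   = p + v , trans (+-comm (p + v) 2) (cong (2 +_) p+v≡) , surgery-new v adj
  ; shifted  = λ w w≢v (q , q+w≡ , adj-q) →
      q , trans (+-suc-suc q w) (cong (2 +_) q+w≡) , surgery-keeps v adj-q (q≢p w≢v q+w≡) adj
  }
  where
  N = length L
  perm : surgery v adj ↭ upTo (suc (suc (suc N)))
  perm = ↭-trans (surgery-↭ v adj)
           (subst (λ n → n ∷ suc n ∷ 0 ∷ ys ↭ upTo (suc (suc (suc N)))) (sym p+v≡)
             (grow-range xs↭))
  +-suc-suc : ∀ q w → q + (2 + w) ≡ 2 + (q + w)
  +-suc-suc q w = trans (+-suc q (suc w)) (cong suc (+-suc q w))
  q≢p : ∀ {q w} → w ≢ v → q + w ≡ suc N → q ≢ p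
  q≢p w≢v q+w≡ refl = w≢v (+-cancelˡ-≡ p _ _ (trans q+w≡ (sym p+v≡)))

Realizable : (List ℕ → List ℕ → Set) → List ℕ → Set
Realizable Inv L = ∃ λ xs → StandardLinearRealization L xs × Inv L xs

EvenPivots : ℕ → List ℕ → List ℕ → Set
EvenPivots d L xs = ∀ f → f < d → Pivot (length L) xs (suc f * 2)

even-step : ∀ {d L} → Realizable (EvenPivots (suc d)) L →
            Realizable (EvenPivots (suc d)) (suc d * 2 ∷ suc d * 2 ∷ L)
even-step {d} {L} (xs , real , pivots) = list , realizes , pivots′
  where
  open Extension (extend real (pivots d ≤-refl))
  pivots′ : EvenPivots (suc d) (suc d * 2 ∷ suc d * 2 ∷ L) list
  pivots′ zero _ = pivot₂
  pivots′ (suc f) (s≤s f<d) =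
    shifted (suc f * 2) (λ eq → <⇒≢ f<d (suc-injective (*-cancelʳ-≡ (suc f) (suc d) 2 eq)))
            (pivots f (m<n⇒m<1+n f<d))

even-repeat : ∀ {d L} q → Realizable (EvenPivots (suc d)) L →
              Realizable (EvenPivots (suc d)) (replicate (q * 2) (suc d * 2) ++ L)
even-repeat zero r = r
even-repeat (suc q) r = even-step (even-repeat q r)

even-weaken : ∀ {d L} → Realizable (EvenPivots (suc d)) L → Realizable (EvenPivots d) L
even-weaken (xs , real , pivots) = xs , real , λ f f<d → pivots f (m<n⇒m<1+n f<d)

evenBlocks : ∀ {m} → ℕ → (Fin m → ℕ) → List ℕ
evenBlocks {m} c b = concatMap (λ i → replicate (b i) (2 * suc (c + toℕ i))) (allFin m)

evenBlocks-suc : ∀ {m} c (b : Fin (suc m) → ℕ) →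
  evenBlocks c b ≡ replicate (b fzero) (suc c * 2) ++ evenBlocks (suc c) (b ∘ fsuc)
evenBlocks-suc {m} c b = cong₂ _++_ (cong (replicate (b fzero)) first) rest
  where
  block : Fin (suc m) → List ℕ
  block i = replicate (b i) (2 * suc (c + toℕ i))
  block′ : Fin m → List ℕ
  block′ i = replicate (b (fsuc i)) (2 * suc (suc c + toℕ i))
  first : 2 * suc (c + 0) ≡ suc c * 2
  first = trans (*-comm 2 (suc (c + 0))) (cong (λ n → suc n * 2) (+-identityʳ c))
  rest : concat (map block (tabulate fsuc)) ≡ concatMap block′ (allFin m)
  rest = begin
    concat (map block (tabulate fsuc))  ≡⟨ cong concat (map-tabulate fsuc block) ⟩
    concat (tabulate (block ∘ fsuc))    ≡⟨ cong concat (tabulate-cong shift-index) ⟩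
    concat (tabulate block′)            ≡⟨ cong concat (map-tabulate (λ i → i) block′) ⟨
    concatMap block′ (allFin m)         ∎
    where
    open ≡-Reasoning
    shift-index : ∀ i → block (fsuc i) ≡ block′ i
    shift-index i = cong (λ n → replicate (b (fsuc i)) (2 * suc n)) (+-suc c (toℕ i))

even-phase : ∀ m c (b : Fin m → ℕ) → (∀ i → 2 ∣ b i) → ∀ {L} →
             Realizable (EvenPivots (c + m)) L → Realizable (EvenPivots c) (evenBlocks c b ++ L)
even-phase zero c b _ {L} r = subst (λ d → Realizable (EvenPivots d) L) (+-identityʳ c) r
even-phase (suc m) c b even {L} r with even fzero
... | divides q b₀≡q*2 =
  subst (Realizable (EvenPivots c)) (sym list≡)
    (even-weaken (even-repeat q (even-phase m (suc c) (b ∘ fsuc) (even ∘ fsuc)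
      (subst (λ d → Realizable (EvenPivots d) L) (+-suc c m) r))))
  where
  rest = evenBlocks (suc c) (b ∘ fsuc)
  list≡ : evenBlocks c b ++ L ≡ replicate (q * 2) (suc c * 2) ++ rest ++ L
  list≡ = begin
    evenBlocks c b ++ L                                    ≡⟨ cong (_++ L) (evenBlocks-suc c b) ⟩
    (replicate (b fzero) (suc c * 2) ++ rest) ++ L        ≡⟨ ++-assoc (replicate (b fzero) _) rest L ⟩
    replicate (b fzero) (suc c * 2) ++ rest ++ L          ≡⟨ cong (λ k → replicate k (suc c * 2) ++ rest ++ L) b₀≡q*2 ⟩
    replicate (q * 2) (suc c * 2) ++ rest ++ L            ∎
    where open ≡-Reasoning

odd≢even : ∀ m n → suc (m * 2) ≢ n * 2
odd≢even zero (suc n) ()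
odd≢even (suc m) (suc n) eq = odd≢even m n (suc-injective (suc-injective eq))

OddPivots : ℕ → ℕ → List ℕ → List ℕ → Set
OddPivots K lo L xs =
  EvenPivots K L xs × (∀ f → lo ≤ f → f ≤ K → Pivot (length L) xs (suc (f * 2)))

odd-step : ∀ {K lo L} → lo ≤ K → Realizable (OddPivots K lo) L →
           Realizable (OddPivots K (suc lo)) (suc (K * 2) ∷ suc (K * 2) ∷ L)
odd-step {K} {lo} {L} lo≤K (xs , real , evens , odds) = list , realizes , evens′ , odds′
  where
  open Extension (extend real (odds K lo≤K ≤-refl))
  L′ = suc (K * 2) ∷ suc (K * 2) ∷ L
  evens′ : EvenPivots K L′ list
  evens′ zero _ = pivot₂
  evens′ (suc f) f<K =
    shifted (suc f * 2) (odd≢even K (suc f) ∘ sym) (evens f (<-trans (n<1+n f) f<K))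
  odds′ : ∀ f → suc lo ≤ f → f ≤ K → Pivot (length L′) list (suc (f * 2))
  odds′ (suc f) (s≤s lo≤f) f<K =
    shifted (suc (f * 2)) (λ eq → <⇒≢ f<K (*-cancelʳ-≡ f K 2 (suc-injective eq)))
            (odds f lo≤f (<⇒≤ f<K))

∣n-suc-n∣≡1 : ∀ n → ∣ n - suc n ∣ ≡ 1
∣n-suc-n∣≡1 zero = refl
∣n-suc-n∣≡1 (suc n) = ∣n-suc-n∣≡1 n

offset-bound : ∀ {a v k n} → a ≤ v → v + k ≡ n → a + k ≤ n
offset-bound {k = k} a≤v v+k≡n = subst (_ ≤_) v+k≡n (+-monoˡ-≤ k a≤v)

descending-↭ : ∀ n → 0 ∷ applyDownFrom suc n ↭ upTo (suc n)
descending-↭ zero = ↭-refl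
descending-↭ (suc n) =
  ↭-trans (swap 0 (suc n) ↭-refl)
    (↭-trans (prep (suc n) (descending-↭ n)) (↭-sym (upTo-suc (suc n))))

descending-diffs : ∀ n → diffs (applyDownFrom suc (suc n)) ≡ replicate n 1
descending-diffs zero = refl
descending-diffs (suc n) =
  cong₂ _∷_ (trans (∣-∣-comm (suc (suc n)) (suc n)) (∣n-suc-n∣≡1 (suc n))) (descending-diffs n)

descending-adjacent : ∀ {p n} → suc (suc p) ≤ n → Adjacent (suc p) (applyDownFrom suc n)
descending-adjacent {p} {suc n} (s≤s p+2≤n+1) with m≤n⇒m<n∨m≡n p+2≤n+1
... | inj₁ p+2≤n = later (descending-adjacent p+2≤n)
... | inj₂ refl = falling

descending-pivot : ∀ {v n} → 2 ≤ v → v ≤ n → Pivot n (0 ∷ applyDownFrom suc n) v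
descending-pivot {v} 2≤v v≤n with m≤n⇒∃[o]m+o≡n v≤n
... | k , v+k≡n =
  suc k , cong suc (trans (+-comm k v) v+k≡n) , later (descending-adjacent (offset-bound 2≤v v+k≡n))

ascending-diffs : ∀ f → (∀ i → f (suc i) ≡ suc (f i)) → ∀ n →
                  diffs (applyUpTo f (suc n)) ≡ replicate n 1
ascending-diffs f step zero = refl
ascending-diffs f step (suc n) =
  cong₂ _∷_ (trans (cong (λ y → ∣ f 0 - y ∣) (step 0)) (∣n-suc-n∣≡1 (f 0)))
            (ascending-diffs (f ∘ suc) (step ∘ suc) n)

ascending-adjacent : ∀ f → (∀ i → f (suc i) ≡ suc (f i)) → ∀ {i n} → suc i < n →
                     Adjacent (f i) (applyUpTo f n)
ascending-adjacent f step {zero} {suc (suc n)} _ =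
  subst (λ y → Adjacent (f 0) (f 0 ∷ y ∷ applyUpTo (f ∘ suc ∘ suc) n)) (sym (step 0)) rising
ascending-adjacent f step {zero} {suc zero} (s≤s ())
ascending-adjacent f step {suc i} {suc n} (s≤s i+1<n) =
  later (ascending-adjacent (f ∘ suc) (step ∘ suc) i+1<n)

even-≤ : ∀ {f K} → f < K → suc f * 2 ≤ suc (K * 2)
even-≤ f<K = m≤n⇒m≤1+n (*-monoˡ-≤ 2 f<K)

odd-≤ : ∀ {f K} → f ≤ K → suc (f * 2) ≤ suc (K * 2)
odd-≤ f≤K = s≤s (*-monoˡ-≤ 2 f≤K)

odd-pivots-from-range : ∀ {K L xs} → Pivot (length L) xs 2 →
  (∀ v → 4 ≤ v → v ≤ suc (K * 2) → Pivot (length L) xs v) → OddPivots K 2 L xs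
odd-pivots-from-range {K} {L} {xs} pivot₂ pivot = evens , odds
  where
  evens : EvenPivots K L xs
  evens zero _ = pivot₂
  evens (suc f) f<K = pivot _ (s≤s (s≤s (s≤s (s≤s z≤n)))) (even-≤ f<K)
  odds : ∀ f → 2 ≤ f → f ≤ K → Pivot (length L) xs (suc (f * 2))
  odds (suc zero) (s≤s ()) _
  odds (suc (suc f)) _ f≤K = pivot _ (s≤s (s≤s (s≤s (s≤s z≤n)))) (odd-≤ f≤K)

base-one : ∀ K → let x = suc (suc K * 2) in
           Realizable (OddPivots (suc K) 1) (x ∷ replicate (suc K * 2) 1)
base-one K = xs , standard (descending-↭ x) (↭-reflexive diffs≡) (_ , refl) , evens , odds
  where
  x = suc (suc K * 2)
  ones = replicate (suc K * 2) 1
  xs = 0 ∷ applyDownFrom suc x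
  diffs≡ : diffs xs ≡ x ∷ ones
  diffs≡ = cong (x ∷_) (descending-diffs (suc K * 2))
  pivot : ∀ v → 2 ≤ v → v ≤ x → Pivot (length (x ∷ ones)) xs v
  pivot v 2≤v v≤x =
    subst (λ n → Pivot n xs v) (sym (cong suc (length-replicate (suc K * 2))))
      (descending-pivot 2≤v v≤x)
  odd-pivots₂ : OddPivots (suc K) 2 (x ∷ ones) xs
  odd-pivots₂ = odd-pivots-from-range {suc K} {x ∷ ones} {xs}
    (pivot 2 ≤-refl (s≤s (s≤s z≤n)))
    (λ v 4≤v → pivot v (≤-trans (s≤s (s≤s z≤n)) 4≤v))
  evens : EvenPivots (suc K) (x ∷ ones) xs
  evens = proj₁ odd-pivots₂
  odds : ∀ f → 1 ≤ f → f ≤ suc K → Pivot (length (x ∷ ones)) xs (suc (f * 2))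
  odds 1 _ 1≤K = pivot 3 (s≤s (s≤s z≤n)) (odd-≤ 1≤K)
  odds (suc (suc f)) _ f≤K = proj₂ odd-pivots₂ (suc (suc f)) (s≤s (s≤s z≤n)) f≤K

-- Base for even s: 0, x, x+1, 1, 2, …, 2K realizes {x, x, 1^(2K)} with
-- x = 2K+1 (K ≥ 1); it has a pivot for 2 at x and pivots for all 4 ≤ v ≤ x
-- in the ascending run.
base-two : ∀ K → let x = suc (suc K * 2) in
           Realizable (OddPivots (suc K) 2) (x ∷ x ∷ replicate (suc K * 2) 1)
base-two K = xs , standard (↭-trans (pull₂ 0 ↭-refl) (grow-range ↭-refl)) ds (_ , refl) ,
             odd-pivots-from-range {suc K} {x ∷ x ∷ ones} {xs} pivot₂ pivot
  where
  x = suc (suc K * 2)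
  ones = replicate (suc K * 2) 1
  run = applyUpTo suc (suc K * 2)
  xs = 0 ∷ x ∷ suc x ∷ run
  ds : diffs xs ↭ x ∷ x ∷ ones
  ds = ↭-trans (↭-reflexive (cong₂ (λ d ds → x ∷ d ∷ x ∷ ds) (∣n-suc-n∣≡1 x)
                                   (ascending-diffs suc (λ _ → refl) (suc (K * 2)))))
               (prep x (swap 1 x ↭-refl))
  |L|≡ : length (x ∷ x ∷ ones) ≡ suc x
  |L|≡ = cong (suc ∘ suc) (length-replicate (suc K * 2))
  pivot₂ : Pivot (length (x ∷ x ∷ ones)) xs 2
  pivot₂ = subst (λ n → Pivot n xs 2) (sym |L|≡) (x , +-comm x 2 , later rising)
  pivot : ∀ v → 4 ≤ v → v ≤ x → Pivot (length (x ∷ x ∷ ones)) xs v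
  pivot v 4≤v v≤x with m≤n⇒∃[o]m+o≡n v≤x
  ... | k , v+k≡x = subst (λ n → Pivot n xs v) (sym |L|≡)
    (suc (suc k) , cong (suc ∘ suc) (trans (+-comm k v) v+k≡x) ,
     later (later (later (ascending-adjacent suc (λ _ → refl) (≤-pred (offset-bound 4≤v v+k≡x))))))

half-double : ∀ K → ⌊ K * 2 /2⌋ ≡ K
half-double zero = refl
half-double (suc K) = cong suc (half-double K)

-- ⌊n/2⌋ ≤ K for n ≤ 2K: the odd phase may step from s to s+2 while s+2 ≤ 2K.
half-bound : ∀ {n K} → n ≤ K * 2 → ⌊ n /2⌋ ≤ K
half-bound {n} {K} n≤2K = subst (⌊ n /2⌋ ≤_) (half-double K) (⌊n/2⌋-mono n≤2K)

-- Odd phase: for 1 ≤ s ≤ 2K, {x^s, 1^(2K)} (x = 2K+1) has a realization with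
-- pivots for 2, …, 2K, obtained from a base by inserting pairs x, x; the odd
-- pivots 2f+1 with f ≤ ⌊s/2⌋ are used up.
odd-phase : ∀ K s → 1 ≤ s → s ≤ K * 2 →
  Realizable (OddPivots K (suc ⌊ s /2⌋)) (replicate s (suc (K * 2)) ++ replicate (K * 2) 1)
odd-phase K zero () _
odd-phase zero (suc _) _ ()
odd-phase (suc K) 1 _ _ = base-one K
odd-phase (suc K) 2 _ _ = base-two K
odd-phase (suc K) (suc (suc (suc s))) _ s+3≤2K =
  odd-step (half-bound s+3≤2K)
    (odd-phase (suc K) (suc s) (s≤s z≤n) (≤-trans (n≤1+n _) (≤-trans (n≤1+n _) s+3≤2K)))

realize : ∀ K s → 1 ≤ s → s ≤ K * 2 → (b : Fin K → ℕ) → (∀ i → 2 ∣ b i) →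
  ∃ λ xs → StandardLinearRealization
             (replicate (K * 2) 1 ++ evenBlocks 0 b ++ replicate s (suc (K * 2))) xs
realize K s 1≤s s≤2K b even with odd-phase K s 1≤s s≤2K
... | xs₁ , real₁ , evens , _ with even-phase K 0 b even (xs₁ , real₁ , evens)
... | xs , real , _ = xs , realization-↭ rearrange real
  where
  ones = replicate (K * 2) 1
  xˢ = replicate s (suc (K * 2))
  rearrange : evenBlocks 0 b ++ xˢ ++ ones ↭ ones ++ evenBlocks 0 b ++ xˢ
  rearrange = ↭-trans (↭-reflexive (sym (++-assoc (evenBlocks 0 b) xˢ ones)))
                      (++-comm (evenBlocks 0 b ++ xˢ) ones)

odd-decomposition : ∀ x → ¬ 2 ∣ x → x ≡ suc (x / 2 * 2)
odd-decomposition x ¬2∣x with x % 2 | m%n<n x 2 | m≡m%n+[m/n]*n x 2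
... | zero | _ | x≡ = ⊥-elim (¬2∣x (divides (x / 2) x≡))
... | suc zero | _ | x≡ = x≡
... | suc (suc _) | s≤s (s≤s ()) | _

proposition4p3 : (x s : ℕ) → 3 ≤ x → ¬ (2 ∣ x) → 1 ≤ s → s ≤ x ∸ 1 →
    (b : Fin (x / 2) → ℕ) → (∀ i → 2 ∣ b i) →
    ∃ λ (xs : List ℕ) → StandardLinearRealization (theList x b s) xs
proposition4p3 x s _ ¬2∣x 1≤s s≤x-1 b even =
  subst (λ y → ∃ λ xs → StandardLinearRealization
                          (replicate (y ∸ 1) 1 ++ evenBlocks 0 b ++ replicate s y) xs)
        (sym x≡)
        (realize (x / 2) s 1≤s (subst (λ y → s ≤ y ∸ 1) x≡ s≤x-1) b even)
  where
  x≡ : x ≡ suc (x / 2 * 2)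
  x≡ = odd-decomposition x ¬2∣x
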